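{- Let $G=(V,E)$ be a finite graph (directed or undirected) with $V\neq\emptyset$ and without self-loops, and let $E=E_1\cup E_2\cup\cdots\cup E_m$ be a partition of its edge set into $m\ge 1$ parts. For $v\in V$ let $d(v)$ be the number of edges of $E$ incident to $v$, let $d(i,v)$ be the number of edges of $E_i$ incident to $v$, and let $\rho(v)$ be the number of indices $i$ such that $v$ is incident to at least one edge of $E_i$. Define $$RF=\frac{1}{|V|}\sum_{v\in V}\rho(v), \qquad MSIDS=\max_{1\le i\le m}\sum_{v\in V} d(i,v)^2 .$$ Then $$RF\cdot MSIDS\ \ge\ \frac{4|E|^2}{m|V|}.$$
   Context: $RF$ is the replication factor of the edge partition (vertex-cut) and $MSIDS$ is the maximal sum of inner degrees squared over the parts. Edges are counted with incidence, so that $\sum_{v\in V} d(v)=2|E|$ and $d(v)=\sum_{i=1}^m d(i,v)$. -}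

module Defs where

open import Data.Nat using (ℕ; zero; suc; _+_; _*_; _⊔_; _<?_; NonZero)
open import Data.Nat.Properties using (m*n≢0)
open import Data.Fin using (Fin; zero; suc)
open import Data.Fin.Properties using () renaming (_≟_ to _≟ᶠ_)
open import Data.Product using (_×_; _,_)
open import Data.Sum using (_⊎_)
open import Data.Integer using (+_)
open import Data.Rational using (ℚ; _/_; _*_)
open import Relation.Nullary using (Dec; yes; no; ¬_)
open import Relation.Nullary.Decidable using (_⊎-dec_; _×-dec_)
open import Relation.Binary.PropositionalEquality using (_≡_)
open import Function.Definitions using (Injective)

∑ : ∀ {n} → (Fin n → ℕ) → ℕ
∑ {zero}  f = 0
∑ {suc n} f = f zero + ∑ (λ i → f (suc i))

maxFin : ∀ {n} → (Fin n → ℕ) → ℕ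
maxFin {zero}  f = 0
maxFin {suc n} f = f zero ⊔ maxFin (λ i → f (suc i))

count : ∀ {n} {P : Fin n → Set} → ((i : Fin n) → Dec (P i)) → ℕ
count {n} P? = ∑ (λ i → indicator (P? i))
  where
  indicator : ∀ {A : Set} → Dec A → ℕ
  indicator (yes _) = 1
  indicator (no _)  = 0

-- A finite graph (directed, or undirected with each edge given an arbitrary
-- orientation) with vertex set Fin n and edge set Fin k, without self-loops;
-- distinct edges have distinct (ordered) endpoint pairs.
record Graph (n k : ℕ) : Set where
  field
    src tgt  : Fin k → Fin n
    noLoop   : ∀ e → ¬ (src e ≡ tgt e)
    simple   : Injective _≡_ _≡_ (λ e → (src e , tgt e))

module _ {n k : ℕ} (G : Graph n k) where
  open Graph G

  Incident : Fin k → Fin n → Set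
  Incident e v = (src e ≡ v) ⊎ (tgt e ≡ v)

  incident? : ∀ e v → Dec (Incident e v)
  incident? e v = (src e ≟ᶠ v) ⊎-dec (tgt e ≟ᶠ v)

  deg : Fin n → ℕ
  deg v = count (λ e → incident? e v)

  module _ {m : ℕ} (part : Fin k → Fin m) where

    degIn : Fin m → Fin n → ℕ
    degIn i v = count (λ e → (part e ≟ᶠ i) ×-dec incident? e v)

    ρ : Fin n → ℕ
    ρ v = count (λ i → 0 <? degIn i v)

    RF : .{{NonZero n}} → ℚ
    RF = (+ ∑ ρ) / n

    MSIDS : ℕ
    MSIDS = maxFin (λ i → ∑ (λ v → degIn i v Data.Nat.* degIn i v))

    bound : .{{NonZero n}} → .{{NonZero m}} → ℚ
    bound = _/_ (+ (4 Data.Nat.* k Data.Nat.* k)) (m Data.Nat.* n) {{m*n≢0 m n}}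

-- For a part E_i write D_i = Σ_v d(i,v) and let c_i be the number of vertices covered by E_i.
-- Cauchy–Schwarz gives D_i² ≤ c_i · Σ_v d(i,v)² ≤ c_i · MSIDS and (Σ_i D_i)² ≤ m · Σ_i D_i².
-- Counting incidences twice, Σ_i D_i = 2|E| and Σ_i c_i = Σ_v ρ(v) = |V| · RF,
-- so 4|E|² ≤ m · MSIDS · |V| · RF.
module Submission where

open import Defs
open import Data.Nat using (ℕ; NonZero)
open import Data.Fin using (Fin)

module Counting where
  open import Data.Bool.Base using (true; false; if_then_else_)
  open import Data.Empty using (⊥-elim)
  open import Data.Fin using (zero; suc)
  open import Data.Fin.Properties using (_≟_)
  open import Data.Nat using (zero; suc; _+_; _*_; _≤_; _<?_)
  open import Data.Nat.Properties hiding (_≟_)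
  open import Data.Nat.Tactic.RingSolver using (solve-∀)
  open import Data.Product using (_×_; _,_)
  open import Data.Sum using ([_,_]′)
  open import Relation.Nullary using (Dec; does; _because_; yes; no; ¬_)
  open import Relation.Nullary.Decidable using (_⊎-dec_; _×-dec_)
  open import Relation.Binary.PropositionalEquality
  open import Algebra.Properties.Semiring.Sum +-*-semiring
    using (sum; sum-cong-≗; sum-replicate-zero; ∑-distrib-+; ∑-comm; *-distribˡ-sum; *-distribʳ-sum)

  ∑≡sum : ∀ {n} (f : Fin n → ℕ) → ∑ f ≡ sum f
  ∑≡sum {zero}  f = refl
  ∑≡sum {suc n} f = cong (f zero +_) (∑≡sum (λ i → f (suc i)))

  sum-mono-≤ : ∀ {n} {f g : Fin n → ℕ} → (∀ i → f i ≤ g i) → sum f ≤ sum g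
  sum-mono-≤ {zero}  f≤g = ≤-refl
  sum-mono-≤ {suc n} f≤g = +-mono-≤ (f≤g zero) (sum-mono-≤ (λ i → f≤g (suc i)))

  sum-const : ∀ n c → sum {n} (λ _ → c) ≡ n * c
  sum-const zero    c = refl
  sum-const (suc n) c = cong (c +_) (sum-const n c)

  sum-*-sum : ∀ {m n} (f : Fin m → ℕ) (g : Fin n → ℕ) →
              sum f * sum g ≡ sum (λ i → sum (λ j → f i * g j))
  sum-*-sum f g = trans (*-distribʳ-sum (sum g) f) (sum-cong-≗ (λ i → *-distribˡ-sum (f i) g))

  ≤-maxFin : ∀ {n} (f : Fin n → ℕ) i → f i ≤ maxFin f
  ≤-maxFin f zero    = m≤m⊔n _ _
  ≤-maxFin f (suc i) = ≤-trans (≤-maxFin (λ j → f (suc j)) i) (m≤n⊔m (f zero) _)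

  -- Only `does` is inspected, so `indicator` computes through `map′`:
  -- `indicator (suc j ≟ suc i)` reduces to `indicator (j ≟ i)`.
  indicator : ∀ {A : Set} → Dec A → ℕ
  indicator a? = if does a? then 1 else 0

  count≡sum-indicator : ∀ {n} {P : Fin n → Set} (P? : ∀ i → Dec (P i)) →
                        count P? ≡ sum (λ i → indicator (P? i))
  count≡sum-indicator {zero}  P? = refl
  count≡sum-indicator {suc n} P? with P? zero
  ... | yes _ = cong suc (count≡sum-indicator (λ i → P? (suc i)))
  ... | no  _ = count≡sum-indicator (λ i → P? (suc i))

  indicator-idem : ∀ {A : Set} (a? : Dec A) → indicator a? * indicator a? ≡ indicator a?
  indicator-idem (true  because _) = refl
  indicator-idem (false because _) = refl

  indicator-× : ∀ {A B : Set} (a? : Dec A) (b? : Dec B) →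
                indicator (a? ×-dec b?) ≡ indicator a? * indicator b?
  indicator-× (true  because _) b? = sym (+-identityʳ (indicator b?))
  indicator-× (false because _) b? = refl

  indicator-⊎ : ∀ {A B : Set} (a? : Dec A) (b? : Dec B) → ¬ (A × B) →
                indicator (a? ⊎-dec b?) ≡ indicator a? + indicator b?
  indicator-⊎ (yes a)           (yes b)           ¬a×b = ⊥-elim (¬a×b (a , b))
  indicator-⊎ (true  because _) (false because _) _    = refl
  indicator-⊎ (false because _) b?                _    = refl

  *-indicator-positive : ∀ x → x * indicator (0 <? x) ≡ x
  *-indicator-positive zero    = refl
  *-indicator-positive (suc x) = *-identityʳ (suc x)

  sum-indicator-≟ : ∀ {n} (j : Fin n) → sum (λ i → indicator (j ≟ i)) ≡ 1
  sum-indicator-≟ {suc n} zero    = cong suc (sum-replicate-zero n)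
  sum-indicator-≟ {suc n} (suc j) = sum-indicator-≟ j

  2*[m*n]≤m*m+n*n : ∀ m n → 2 * (m * n) ≤ m * m + n * n
  2*[m*n]≤m*m+n*n m n = [ ordered , swapped ]′ (≤-total m n)
    where
    ordered : ∀ {m n} → m ≤ n → 2 * (m * n) ≤ m * m + n * n
    ordered {m} m≤n with d , refl ← m≤n⇒∃[o]m+o≡n m≤n =
      ≤-trans (m≤m+n _ (d * d)) (≤-reflexive (expand m d))
      where
      expand : ∀ m d → 2 * (m * (m + d)) + d * d ≡ m * m + (m + d) * (m + d)
      expand = solve-∀
    swapped : n ≤ m → 2 * (m * n) ≤ m * m + n * n
    swapped n≤m = subst₂ _≤_ (cong (2 *_) (*-comm n m)) (+-comm (n * n) (m * m)) (ordered n≤m)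

  cauchy-schwarz : ∀ {n} (a b : Fin n → ℕ) →
                   sum (λ i → a i * b i) * sum (λ i → a i * b i) ≤
                   sum (λ i → a i * a i) * sum (λ i → b i * b i)
  cauchy-schwarz {n} a b = *-cancelˡ-≤ 2 (begin
    2 * (sum ab * sum ab)
      ≡⟨ cong (2 *_) (sum-*-sum ab ab) ⟩
    2 * sum (λ i → sum (λ j → ab i * ab j))
      ≡⟨ *-distribˡ-sum 2 (λ i → sum (λ j → ab i * ab j)) ⟩
    sum (λ i → 2 * sum (λ j → ab i * ab j))
      ≡⟨ sum-cong-≗ (λ i → *-distribˡ-sum 2 (λ j → ab i * ab j)) ⟩
    sum (λ i → sum (λ j → 2 * (ab i * ab j)))
      ≤⟨ sum-mono-≤ (λ i → sum-mono-≤ (cross-term i)) ⟩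
    sum (λ i → sum (λ j → aa i * bb j + aa j * bb i))
      ≡⟨ sum-cong-≗ (λ i → ∑-distrib-+ (λ j → aa i * bb j) (λ j → aa j * bb i)) ⟩
    sum (λ i → sum (λ j → aa i * bb j) + sum (λ j → aa j * bb i))
      ≡⟨ ∑-distrib-+ (λ i → sum (λ j → aa i * bb j)) (λ i → sum (λ j → aa j * bb i)) ⟩
    sum (λ i → sum (λ j → aa i * bb j)) + sum (λ i → sum (λ j → aa j * bb i))
      ≡⟨ cong (sum (λ i → sum (λ j → aa i * bb j)) +_) (∑-comm (λ i j → aa j * bb i)) ⟩
    sum (λ i → sum (λ j → aa i * bb j)) + sum (λ j → sum (λ i → aa j * bb i))
      ≡⟨ cong (λ s → s + s) (sym (sum-*-sum aa bb)) ⟩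
    sum aa * sum bb + sum aa * sum bb
      ≡⟨ cong (sum aa * sum bb +_) (sym (+-identityʳ _)) ⟩
    2 * (sum aa * sum bb) ∎)
    where
    open ≤-Reasoning
    ab aa bb : Fin n → ℕ
    ab i = a i * b i
    aa i = a i * a i
    bb i = b i * b i
    regroup : ∀ x y z w → (x * y) * (z * w) ≡ (x * w) * (z * y)
    regroup = solve-∀
    square-product : ∀ x y → (x * y) * (x * y) ≡ (x * x) * (y * y)
    square-product = solve-∀
    cross-term : ∀ i j → 2 * (ab i * ab j) ≤ aa i * bb j + aa j * bb i
    cross-term i j = subst₂ _≤_
      (cong (2 *_) (sym (regroup (a i) (b i) (a j) (b j))))
      (cong₂ _+_ (square-product (a i) (b j)) (square-product (a j) (b i)))
      (2*[m*n]≤m*m+n*n (a i * b j) (a j * b i))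

  sum-square≤size*sum-squares : ∀ {n} (f : Fin n → ℕ) →
                                sum f * sum f ≤ n * sum (λ i → f i * f i)
  sum-square≤size*sum-squares {n} f = subst₂ _≤_
    (cong (λ s → s * s) (sum-cong-≗ (λ i → *-identityʳ (f i))))
    (trans (cong (sum (λ i → f i * f i) *_) (trans (sum-const n 1) (*-identityʳ n))) (*-comm _ n))
    (cauchy-schwarz f (λ _ → 1))

  sum-square≤sum-squares*support : ∀ {n} (f : Fin n → ℕ) →
    sum f * sum f ≤ sum (λ i → f i * f i) * sum (λ i → indicator (0 <? f i))
  sum-square≤sum-squares*support f = subst₂ (λ s t → s * s ≤ sum (λ i → f i * f i) * t)
    (sum-cong-≗ (λ i → *-indicator-positive (f i)))
    (sum-cong-≗ (λ i → indicator-idem (0 <? f i)))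
    (cauchy-schwarz f (λ i → indicator (0 <? f i)))

  module _ {n k : ℕ} (G : Graph n k) where
    open Graph G

    sum-incident≡2 : ∀ e → sum (λ v → indicator (incident? G e v)) ≡ 2
    sum-incident≡2 e = begin
      sum (λ v → indicator (incident? G e v))
        ≡⟨ sum-cong-≗ (λ v → indicator-⊎ (src e ≟ v) (tgt e ≟ v) (not-both v)) ⟩
      sum (λ v → indicator (src e ≟ v) + indicator (tgt e ≟ v))
        ≡⟨ ∑-distrib-+ (λ v → indicator (src e ≟ v)) (λ v → indicator (tgt e ≟ v)) ⟩
      sum (λ v → indicator (src e ≟ v)) + sum (λ v → indicator (tgt e ≟ v))
        ≡⟨ cong₂ _+_ (sum-indicator-≟ (src e)) (sum-indicator-≟ (tgt e)) ⟩
      2 ∎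
      where
      open ≡-Reasoning
      not-both : ∀ v → ¬ (src e ≡ v × tgt e ≡ v)
      not-both v (src≡v , tgt≡v) = noLoop e (trans src≡v (sym tgt≡v))

    module _ {m : ℕ} (part : Fin k → Fin m) where

      covered : Fin m → ℕ
      covered i = sum (λ v → indicator (0 <? degIn G part i v))

      degIn≡sum : ∀ i v →
        degIn G part i v ≡ sum (λ e → indicator (part e ≟ i) * indicator (incident? G e v))
      degIn≡sum i v = trans (count≡sum-indicator (λ e → (part e ≟ i) ×-dec incident? G e v))
                            (sum-cong-≗ (λ e → indicator-× (part e ≟ i) (incident? G e v)))

      sum-degIn≡k*2 : sum (λ i → sum (λ v → degIn G part i v)) ≡ k * 2
      sum-degIn≡k*2 = begin
        sum (λ i → sum (λ v → degIn G part i v))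
          ≡⟨ sum-cong-≗ (λ i → sum-cong-≗ (degIn≡sum i)) ⟩
        sum (λ i → sum (λ v → sum (λ e → inPart e i * incident e v)))
          ≡⟨ sum-cong-≗ (λ i → ∑-comm (λ v e → inPart e i * incident e v)) ⟩
        sum (λ i → sum (λ e → sum (λ v → inPart e i * incident e v)))
          ≡⟨ ∑-comm (λ i e → sum (λ v → inPart e i * incident e v)) ⟩
        sum (λ e → sum (λ i → sum (λ v → inPart e i * incident e v)))
          ≡⟨ sum-cong-≗ (λ e → sym (sum-*-sum (inPart e) (incident e))) ⟩
        sum (λ e → sum (inPart e) * sum (incident e))
          ≡⟨ sum-cong-≗ (λ e → cong₂ _*_ (sum-indicator-≟ (part e)) (sum-incident≡2 e)) ⟩
        sum {k} (λ _ → 2)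
          ≡⟨ sum-const k 2 ⟩
        k * 2 ∎
        where
        open ≡-Reasoning
        inPart : Fin k → Fin m → ℕ
        inPart e i = indicator (part e ≟ i)
        incident : Fin k → Fin n → ℕ
        incident e v = indicator (incident? G e v)

      ∑ρ≡sum-covered : ∑ (ρ G part) ≡ sum covered
      ∑ρ≡sum-covered = begin
        ∑ (ρ G part)
          ≡⟨ ∑≡sum (ρ G part) ⟩
        sum (ρ G part)
          ≡⟨ sum-cong-≗ (λ v → count≡sum-indicator (λ i → 0 <? degIn G part i v)) ⟩
        sum (λ v → sum (λ i → indicator (0 <? degIn G part i v)))
          ≡⟨ ∑-comm (λ v i → indicator (0 <? degIn G part i v)) ⟩
        sum covered ∎
        where open ≡-Reasoning

      sum-squares≤MSIDS : ∀ i → sum (λ v → degIn G part i v * degIn G part i v) ≤ MSIDS G part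
      sum-squares≤MSIDS i =
        subst (_≤ MSIDS G part) (∑≡sum (λ v → degIn G part i v * degIn G part i v))
          (≤-maxFin (λ j → ∑ (λ v → degIn G part j v * degIn G part j v)) i)

      sum-degIn-square≤MSIDS*covered : ∀ i →
        sum (degIn G part i) * sum (degIn G part i) ≤ MSIDS G part * covered i
      sum-degIn-square≤MSIDS*covered i = ≤-trans
        (sum-square≤sum-squares*support (degIn G part i))
        (*-monoˡ-≤ (covered i) (sum-squares≤MSIDS i))

      4k²≤m*∑ρ*MSIDS : 4 * k * k ≤ m * (∑ (ρ G part) * MSIDS G part)
      4k²≤m*∑ρ*MSIDS = begin
        4 * k * k
          ≡⟨ four-k² k ⟩
        (k * 2) * (k * 2)
          ≡⟨ cong (λ s → s * s) (sym sum-degIn≡k*2) ⟩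
        sum D * sum D
          ≤⟨ sum-square≤size*sum-squares D ⟩
        m * sum (λ i → D i * D i)
          ≤⟨ *-monoʳ-≤ m (sum-mono-≤ sum-degIn-square≤MSIDS*covered) ⟩
        m * sum (λ i → MSIDS G part * covered i)
          ≡⟨ cong (m *_) (sym (*-distribˡ-sum (MSIDS G part) covered)) ⟩
        m * (MSIDS G part * sum covered)
          ≡⟨ cong (λ s → m * (MSIDS G part * s)) (sym ∑ρ≡sum-covered) ⟩
        m * (MSIDS G part * ∑ (ρ G part))
          ≡⟨ cong (m *_) (*-comm (MSIDS G part) _) ⟩
        m * (∑ (ρ G part) * MSIDS G part) ∎
        where
        open ≤-Reasoning
        D : Fin m → ℕ
        D i = sum (degIn G part i)
        four-k² : ∀ k → 4 * k * k ≡ (k * 2) * (k * 2)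
        four-k² = solve-∀

module RationalScaling where
  open import Data.Nat using (suc; _*_; _≤_)
  open import Data.Nat.Properties using (*-identityʳ; *-monoˡ-≤; m*n≢0)
  open import Data.Nat.Tactic.RingSolver using (solve-∀)
  open import Data.Integer as ℤ using (+_)
  open import Data.Integer.Properties using (pos-*)
  open import Data.Rational as ℚ using (toℚᵘ)
  open import Data.Rational.Properties using (toℚᵘ-fromℚᵘ; toℚᵘ-cancel-≤; toℚᵘ-homo-*)
  open import Data.Rational.Unnormalised as ℚᵘ using (mkℚᵘ; *≤*)
  open import Data.Rational.Unnormalised.Properties using (module ≤-Reasoning; *-cong; ≃-sym)
  open import Relation.Binary.PropositionalEquality using (_≡_; cong; sym; trans; subst₂)

  -- `i ℚ./ suc d` is by definition `fromℚᵘ (mkℚᵘ i d)`.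
  toℚᵘ-/ : ∀ i d .{{_ : NonZero d}} → toℚᵘ (i ℚ./ d) ℚᵘ.≃ i ℚᵘ./ d
  toℚᵘ-/ i (suc d) = toℚᵘ-fromℚᵘ (mkℚᵘ i d)

  a/[m*n]≤b/n*c : ∀ {a b c} m n .{{_ : NonZero m}} .{{_ : NonZero n}} → a ≤ m * (b * c) →
                  ((+ a) ℚ./ (m * n)) {{m*n≢0 m n}} ℚ.≤ ((+ b) ℚ./ n) ℚ.* ((+ c) ℚ./ 1)
  a/[m*n]≤b/n*c {a} {b} {c} m@(suc _) n@(suc _) a≤m*bc = toℚᵘ-cancel-≤ (begin
    toℚᵘ (+ a ℚ./ (m * n))
      ≃⟨ toℚᵘ-/ (+ a) (m * n) ⟩
    + a ℚᵘ./ (m * n)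
      ≤⟨ *≤* (subst₂ ℤ._≤_ (pos-* a (n * 1)) pos-bc*mn (ℤ.+≤+ cross-multiplied)) ⟩
    (+ b ℚᵘ./ n) ℚᵘ.* (+ c ℚᵘ./ 1)
      ≃⟨ ≃-sym (*-cong (toℚᵘ-/ (+ b) n) (toℚᵘ-/ (+ c) 1)) ⟩
    toℚᵘ (+ b ℚ./ n) ℚᵘ.* toℚᵘ (+ c ℚ./ 1)
      ≃⟨ ≃-sym (toℚᵘ-homo-* (+ b ℚ./ n) (+ c ℚ./ 1)) ⟩
    toℚᵘ ((+ b ℚ./ n) ℚ.* (+ c ℚ./ 1)) ∎)
    where
    open ≤-Reasoning
    reassociate : ∀ m n b c → m * (b * c) * n ≡ b * c * (m * n)
    reassociate = solve-∀
    cross-multiplied : a * (n * 1) ≤ b * c * (m * n)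
    cross-multiplied = subst₂ _≤_ (cong (a *_) (sym (*-identityʳ n))) (reassociate m n b c)
      (*-monoˡ-≤ n a≤m*bc)
    pos-bc*mn : + (b * c * (m * n)) ≡ (+ b ℤ.* + c) ℤ.* + (m * n)
    pos-bc*mn = trans (pos-* (b * c) (m * n)) (cong (ℤ._* + (m * n)) (pos-* b c))

open import Data.Integer using (+_)
open import Data.Rational using (_≤_; _*_; _/_)
open Counting using (4k²≤m*∑ρ*MSIDS)
open RationalScaling using (a/[m*n]≤b/n*c)

theorem3 : (n k m : ℕ) → .{{_ : NonZero n}} → .{{_ : NonZero m}} →
           (G : Graph n k) → (part : Fin k → Fin m) →
           bound G part ≤ RF G part * ((+ MSIDS G part) / 1)
theorem3 n k m G part =
  a/[m*n]≤b/n*c {b = ∑ (ρ G part)} {c = MSIDS G part} m n (4k²≤m*∑ρ*MSIDS G part)
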